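{- Given an element $a$ of a temporal Heyting algebra $A$, $a$ is $\mathsf{P}$-compatible iff ${\uparrow}a$ is a $\mathsf{P}$-filter.
   Context: Write $\mathsf{P}$ for the "past diamond" operator (black diamond). A temporal Heyting algebra is a Heyting algebra with operators $\Box,\mathsf{P}$ such that $\Box(a\wedge b)=\Box a\wedge\Box b$, $a\le\Box a$, $\Box a\le b\vee(b\to a)$, and $\mathsf{P}a\le b\iff a\le\Box b$. An element $a$ is $\mathsf{P}$-compatible if $a\wedge\mathsf{P}b\le\mathsf{P}(a\wedge b)$ for all $b\in A$. A $\mathsf{P}$-filter is a filter $F$ such that $a\to b\in F$ implies $\mathsf{P}a\to\mathsf{P}b\in F$. -}

module Defs where

open import Level using (Level; _⊔_; suc)
open import Data.Product using (_×_; _,_)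
open import Function.Bundles using (_⇔_)
open import Relation.Unary using (Pred; _∈_)
open import Relation.Binary.Lattice.Bundles using (HeytingAlgebra)

-- Since the stdlib Heyting algebra is over a setoid (_≈_), we also
-- require □ and P to be well-defined (respect _≈_).
record TemporalHeytingAlgebra c ℓ₁ ℓ₂ : Set (suc (c ⊔ ℓ₁ ⊔ ℓ₂)) where
  field
    heytingAlgebra : HeytingAlgebra c ℓ₁ ℓ₂
  open HeytingAlgebra heytingAlgebra public
  field
    □          : Carrier → Carrier
    P          : Carrier → Carrier
    □-cong     : ∀ {a b} → a ≈ b → □ a ≈ □ b
    P-cong     : ∀ {a b} → a ≈ b → P a ≈ P b
    □-∧        : ∀ a b → □ (a ∧ b) ≈ (□ a ∧ □ b)
    □-infl     : ∀ a → a ≤ □ a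
    □-ax       : ∀ a b → □ a ≤ (b ∨ (b ⇨ a))
    P⊣□        : ∀ a b → (P a ≤ b) ⇔ (a ≤ □ b)

module _ {c ℓ₁ ℓ₂} (A : TemporalHeytingAlgebra c ℓ₁ ℓ₂) where
  open TemporalHeytingAlgebra A

  IsPCompatible : Carrier → Set (c ⊔ ℓ₂)
  IsPCompatible a = ∀ b → (a ∧ P b) ≤ P (a ∧ b)

  record IsFilter {ℓ} (F : Pred Carrier ℓ) : Set (c ⊔ ℓ ⊔ ℓ₂) where
    field
      ⊤∈F     : ⊤ ∈ F
      up-closed : ∀ {x y} → x ≤ y → x ∈ F → y ∈ F
      ∧-closed  : ∀ {x y} → x ∈ F → y ∈ F → (x ∧ y) ∈ F

  record IsPFilter {ℓ} (F : Pred Carrier ℓ) : Set (c ⊔ ℓ ⊔ ℓ₂) where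
    field
      isFilter : IsFilter F
      P-closed : ∀ {x y} → (x ⇨ y) ∈ F → (P x ⇨ P y) ∈ F

  ↑_ : Carrier → Pred Carrier ℓ₂
  ↑ a = λ x → a ≤ x

-- Membership x ⇨ y ∈ ↑a means a ∧ x ≤ y, so P-closure of ↑a says that
-- a ∧ x ≤ y implies a ∧ P x ≤ P y. P-compatibility yields this because P,
-- a left adjoint, is monotone; conversely, the instance a ∧ b ≤ a ∧ b with
-- x = b is exactly a ∧ P b ≤ P (a ∧ b).
module Submission where

open import Defs
open import Function.Bundles using (_⇔_; mk⇔; Equivalence)

module _ {c ℓ₁ ℓ₂} (A : TemporalHeytingAlgebra c ℓ₁ ℓ₂) where
  open TemporalHeytingAlgebra A

  P⊣□-unit : ∀ x → x ≤ □ (P x)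
  P⊣□-unit x = Equivalence.to (P⊣□ x (P x)) refl

  P-monotone : ∀ {x y} → x ≤ y → P x ≤ P y
  P-monotone {x} {y} x≤y = Equivalence.from (P⊣□ x (P y)) (trans x≤y (P⊣□-unit y))

  ↑-isFilter : ∀ a → IsFilter A (↑_ A a)
  ↑-isFilter a = record
    { ⊤∈F       = maximum a
    ; up-closed = λ x≤y a≤x → trans a≤x x≤y
    ; ∧-closed  = ∧-greatest
    }

  PCompatible⇒↑-P-closed : ∀ {a} → IsPCompatible A a →
                           ∀ {x y} → a ≤ (x ⇨ y) → a ≤ (P x ⇨ P y)
  PCompatible⇒↑-P-closed {a} compatible {x} a≤x⇨y =
    transpose-⇨ (trans (compatible x) (P-monotone (transpose-∧ a≤x⇨y)))

  ↑-P-closed⇒PCompatible : ∀ {a} → (∀ {x y} → a ≤ (x ⇨ y) → a ≤ (P x ⇨ P y)) →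
                           IsPCompatible A a
  ↑-P-closed⇒PCompatible P-closed b = transpose-∧ (P-closed (transpose-⇨ refl))

proposition3p17 : ∀ {c ℓ₁ ℓ₂} (A : TemporalHeytingAlgebra c ℓ₁ ℓ₂)
                    (a : TemporalHeytingAlgebra.Carrier A) →
                    IsPCompatible A a ⇔ IsPFilter A (↑_ A a)
proposition3p17 A a = mk⇔
  (λ compatible → record
    { isFilter = ↑-isFilter A a
    ; P-closed = PCompatible⇒↑-P-closed A compatible
    })
  (λ ↑a-isPFilter → ↑-P-closed⇒PCompatible A (IsPFilter.P-closed ↑a-isPFilter))
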